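{- $\alpha_{A}(w_{1}*w_{2})=\alpha_{A}(w_{1})*\alpha_{A}(w_{2})$ for $w_{1},w_{2}\in\mathfrak{h}^{1}$.
   Context: Let $\mathfrak{h}=\mathbb{Q}\langle x,y\rangle$, $\mathfrak{h}^1=\mathbb{Q}\oplus y\mathfrak{h}$, $z_k=yx^{k-1}$. The harmonic product $*$ on $\mathfrak{h}^1$ (extended coefficientwise to $\mathfrak{h}^1[[A]]$): $w*1=1*w=w$, $z_kw_1*z_lw_2=z_k(w_1*z_lw_2)+z_l(z_kw_1*w_2)+z_{k+l}(w_1*w_2)$. The shuffle product $\mathbin{\sqcup\!\sqcup}$ on $\mathfrak{h}$: $w\mathbin{\sqcup\!\sqcup}1=1\mathbin{\sqcup\!\sqcup}w=w$, $u_1w_1\mathbin{\sqcup\!\sqcup}u_2w_2=u_1(w_1\mathbin{\sqcup\!\sqcup}u_2w_2)+u_2(u_1w_1\mathbin{\sqcup\!\sqcup}w_2)$ ($u_i\in\{x,y\}$), extended to power series in $A$. Define the linear map $\alpha_A:\mathfrak{h}\to\mathfrak{h}[[A]]$ by $\alpha_A(1)=1$ and $\alpha_A(vw)=v\left(\frac{1}{1+xA}\mathbin{\sqcup\!\sqcup}w\right)$ for $v\in\{x,y\}$, $w\in\mathfrak{h}$, where $\frac{1}{1+xA}=\sum_{n\ge0}(-A)^nx^n$. -}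

module Defs where

open import Data.Nat using (ℕ; zero; suc; _∸_) renaming (_+_ to _+ℕ_)
open import Data.Rational using (ℚ; 0ℚ; 1ℚ; _+_; _*_; -_)
open import Data.List using (List; []; _∷_; _++_; map; concatMap; replicate; foldr; upTo)
open import Data.List.Properties using (≡-dec)
open import Data.Maybe using (Maybe; just; nothing)
open import Data.Product using (_×_; _,_; proj₂)
open import Data.List.Relation.Unary.All using (All)
open import Relation.Binary.PropositionalEquality using (_≡_)
open import Relation.Nullary using (yes; no; Dec)

data Letter : Set where
  x y : Letter

_≟L_ : (a b : Letter) → Dec (a ≡ b)
x ≟L x = yes _≡_.refl
x ≟L y = no (λ ())
y ≟L x = no (λ ())
y ≟L y = yes _≡_.refl

Word : Set
Word = List Letter

_≟W_ : (u v : Word) → Dec (u ≡ v)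
_≟W_ = ≡-dec _≟L_

-- Elements of 𝔥: finite formal ℚ-linear combinations of words
Poly : Set
Poly = List (ℚ × Word)

-- coefficient of a word in a polynomial (equality in 𝔥 is coefficientwise)
coeff : Poly → Word → ℚ
coeff [] w = 0ℚ
coeff ((c , u) ∷ p) w with u ≟W w
... | yes _ = c + coeff p w
... | no  _ = coeff p w

scale : ℚ → Poly → Poly
scale c = map (λ { (d , u) → (c * d , u) })

ofWords : List Word → Poly
ofWords = map (λ u → (1ℚ , u))

-- 𝔥¹ = ℚ ⊕ y𝔥 : a word lies in 𝔥¹ iff it is empty or starts with y
data InH1Word : Word → Set where
  h1-empty : InH1Word []
  h1-y     : (w : Word) → InH1Word (y ∷ w)

InH1 : Poly → Set
InH1 p = All (λ t → InH1Word (proj₂ t)) p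

shW : Word → Word → List Word
shW [] v = v ∷ []
shW (a ∷ u) [] = (a ∷ u) ∷ []
shW (a ∷ u) (b ∷ v) = map (a ∷_) (shW u (b ∷ v)) ++ map (b ∷_) (shW (a ∷ u) v)

-- Harmonic product. A word of 𝔥¹ is z_{k₁}…z_{kᵣ}; we encode z_k by k ∸ 1.
ZWord : Set
ZWord = List ℕ

harZ : ZWord → ZWord → List ZWord
harZ [] v = v ∷ []
harZ (a ∷ u) [] = (a ∷ u) ∷ []
harZ (a ∷ u) (b ∷ v) =
  map (a ∷_) (harZ u (b ∷ v)) ++ map (b ∷_) (harZ (a ∷ u) v)
    ++ map (suc (a +ℕ b) ∷_) (harZ u v)   -- z_{k+l}, (k+l)∸1 = suc((k∸1)+(l∸1))

-- z-words to words: z_{n+1} = y x^n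
unZ : ZWord → Word
unZ [] = []
unZ (n ∷ zs) = (y ∷ replicate n x) ++ unZ zs

parseZ : ℕ → Word → Maybe ZWord
parseZ n [] = just (n ∷ [])
parseZ n (x ∷ w) = parseZ (suc n) w
parseZ n (y ∷ w) = Data.Maybe.map (n ∷_) (parseZ 0 w)

parse : Word → Maybe ZWord
parse [] = just []
parse (x ∷ w) = nothing
parse (y ∷ w) = parseZ 0 w

-- harmonic product of two words of 𝔥¹ (set to 0 outside 𝔥¹; never used there)
harW : Word → Word → List Word
harW u v with parse u | parse v
... | just zu | just zv = map unZ (harZ zu zv)
... | _ | _ = []

bilin : (Word → Word → List Word) → Poly → Poly → Poly
bilin op p q =
  concatMap (λ { (c , u) → concatMap (λ { (d , v) → scale (c * d) (ofWords (op u v)) }) q }) p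

_*h_ : Poly → Poly → Poly
_*h_ = bilin harW

_⧢_ : Poly → Poly → Poly
_⧢_ = bilin shW

-- Power series in A with coefficients in 𝔥: n ↦ coefficient of Aⁿ
Series : Set
Series = ℕ → Poly

_≈S_ : Series → Series → Set
F ≈S G = ∀ n w → coeff (F n) w ≡ coeff (G n) w

bilinS : (Poly → Poly → Poly) → Series → Series → Series
bilinS op F G n = concatMap (λ i → op (F i) (G (n ∸ i))) (upTo (suc n))

_*S_ : Series → Series → Series
_*S_ = bilinS _*h_

sign : ℕ → ℚ
sign zero = 1ℚ
sign (suc n) = - sign n

-- 1/(1+xA) = Σ (-A)ⁿ xⁿ
geomX : Series
geomX n = (sign n , replicate n x) ∷ []

prefix : Letter → Poly → Poly
prefix v = map (λ { (c , u) → (c , v ∷ u) })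

αW : Word → Series
αW [] zero = (1ℚ , []) ∷ []
αW [] (suc n) = []
αW (v ∷ w) n = prefix v (geomX n ⧢ ((1ℚ , w) ∷ []))

αA : Poly → Series
αA p n = concatMap (λ { (c , u) → scale c (αW u n) }) p

module Submission where

-- Both sides are bilinear and are compared coefficientwise, so it suffices to pair them with an
-- arbitrary test function g : Word → ℚ (a coefficient is the pairing with a Kronecker delta) and
-- to treat single words of 𝔥¹.  Shuffling x^a with 1/(1+xA) gives
--   α_A(z_k w) = Σᵢ cₖ(i) Aⁱ z_(k+i) α_A(w),   cₖ(i) the coefficient of Aⁱ in (1+A)^-k.
-- The theorem then follows by induction along the recursion of the harmonic product: the z_k- and
-- z_l-terms match by the induction hypothesis, and the z_(k+l)-term because
-- (1+A)^-k (1+A)^-l = (1+A)^-(k+l), i.e. Vandermonde's identity for cₖ.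

open import Defs
open import Algebra.Bundles using (CommutativeMonoid)
import Algebra.Properties.CommutativeSemigroup as CommSemigroupProperties
open import Data.Bool using (if_then_else_)
open import Data.List using (List; []; _∷_; _++_; map; concatMap; replicate; applyUpTo)
open import Data.List.Properties using (map-++; map-∘; ++-identityʳ)
open import Data.List.Relation.Unary.All using (All; []; _∷_)
open import Data.Maybe using (just; nothing) renaming (map to mapMaybe)
open import Data.Nat using (ℕ; zero; suc; _∸_; _≤_; z≤n; s≤s) renaming (_+_ to _+ℕ_)
import Data.Nat.Properties as ℕ
open import Data.Product using (_,_; proj₁; proj₂)
open import Data.Rational using (ℚ; 0ℚ; 1ℚ; _+_; _*_; -_)
open import Data.Rational.Properties
  using (+-assoc; +-comm; +-identityˡ; +-identityʳ; *-identityˡ; *-identityʳ; *-zeroʳ;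
         *-distribˡ-+; *-distribʳ-+; *-assoc; *-comm; neg-distribˡ-*;
         +-0-commutativeMonoid; *-1-commutativeMonoid)
open import Function using (_∘_)
open import Relation.Binary.PropositionalEquality
open import Relation.Nullary using (yes; no; does)

open CommSemigroupProperties (CommutativeMonoid.commutativeSemigroup +-0-commutativeMonoid)
  using () renaming (interchange to +-interchange; x∙yz≈y∙xz to +-exchangeˡ)
open CommSemigroupProperties (CommutativeMonoid.commutativeSemigroup *-1-commutativeMonoid)
  using () renaming (interchange to *-interchange; x∙yz≈y∙xz to *-exchangeˡ)
open CommSemigroupProperties ℕ.+-commutativeSemigroup
  using () renaming (interchange to ℕ-+-interchange)

private variable A B : Set

-- Finite sums

sumTo : ℕ → (ℕ → ℚ) → ℚ
sumTo zero    h = h 0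
sumTo (suc n) h = h 0 + sumTo n (h ∘ suc)

sumTo-cong : ∀ n {h h′} → (∀ i → h i ≡ h′ i) → sumTo n h ≡ sumTo n h′
sumTo-cong zero    eq = eq 0
sumTo-cong (suc n) eq = cong₂ _+_ (eq 0) (sumTo-cong n (eq ∘ suc))

sumTo-cong-≤ : ∀ n {h h′} → (∀ i → i ≤ n → h i ≡ h′ i) → sumTo n h ≡ sumTo n h′
sumTo-cong-≤ zero    eq = eq 0 z≤n
sumTo-cong-≤ (suc n) eq = cong₂ _+_ (eq 0 z≤n) (sumTo-cong-≤ n (λ i i≤n → eq (suc i) (s≤s i≤n)))

sumTo-+ : ∀ n (h h′ : ℕ → ℚ) → sumTo n (λ i → h i + h′ i) ≡ sumTo n h + sumTo n h′
sumTo-+ zero    h h′ = refl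
sumTo-+ (suc n) h h′ = trans (cong (h 0 + h′ 0 +_) (sumTo-+ n (h ∘ suc) (h′ ∘ suc)))
                             (+-interchange (h 0) (h′ 0) (sumTo n (h ∘ suc)) (sumTo n (h′ ∘ suc)))

sumTo-*ˡ : ∀ n c (h : ℕ → ℚ) → sumTo n (λ i → c * h i) ≡ c * sumTo n h
sumTo-*ˡ zero    c h = refl
sumTo-*ˡ (suc n) c h = trans (cong (c * h 0 +_) (sumTo-*ˡ n c (h ∘ suc))) (sym (*-distribˡ-+ c _ _))

sumTo-*ʳ : ∀ n (h : ℕ → ℚ) c → sumTo n h * c ≡ sumTo n (λ i → h i * c)
sumTo-*ʳ n h c = trans (*-comm (sumTo n h) c)
  (trans (sym (sumTo-*ˡ n c h)) (sumTo-cong n (λ i → *-comm c (h i))))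

sumTo-zero : ∀ n {h} → (∀ i → h i ≡ 0ℚ) → sumTo n h ≡ 0ℚ
sumTo-zero zero    eq = eq 0
sumTo-zero (suc n) eq = trans (cong₂ _+_ (eq 0) (sumTo-zero n (eq ∘ suc))) (+-identityˡ 0ℚ)

sumTo-last : ∀ n (h : ℕ → ℚ) → sumTo (suc n) h ≡ sumTo n h + h (suc n)
sumTo-last zero    h = refl
sumTo-last (suc n) h = trans (cong (h 0 +_) (sumTo-last n (h ∘ suc)))
                             (sym (+-assoc (h 0) (sumTo n (h ∘ suc)) (h (suc (suc n)))))

sumTo-swap : ∀ n m (h : ℕ → ℕ → ℚ) →
  sumTo n (λ i → sumTo m (h i)) ≡ sumTo m (λ j → sumTo n (λ i → h i j))
sumTo-swap zero    m h = refl
sumTo-swap (suc n) m h = trans (cong (sumTo m (h 0) +_) (sumTo-swap n m (h ∘ suc)))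
                               (sym (sumTo-+ m (h 0) _))

conv : ℕ → (ℕ → ℕ → ℚ) → ℚ
conv n F = sumTo n (λ i → F i (n ∸ i))

conv-cong : ∀ n {F G} → (∀ i j → i +ℕ j ≡ n → F i j ≡ G i j) → conv n F ≡ conv n G
conv-cong n eq = sumTo-cong-≤ n (λ i i≤n → eq i (n ∸ i) (ℕ.m+[n∸m]≡n i≤n))

conv-+ : ∀ n (F G : ℕ → ℕ → ℚ) → conv n (λ i j → F i j + G i j) ≡ conv n F + conv n G
conv-+ n F G = sumTo-+ n _ _

conv-* : ∀ n c (F : ℕ → ℕ → ℚ) → conv n (λ i j → c * F i j) ≡ c * conv n F
conv-* n c F = sumTo-*ˡ n c _

conv-last : ∀ n (F : ℕ → ℕ → ℚ) → conv (suc n) F ≡ conv n (λ i j → F i (suc j)) + F (suc n) 0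
conv-last n F = trans (sumTo-last n _)
  (cong₂ _+_ (sumTo-cong-≤ n (λ i i≤n → cong (F i) (ℕ.+-∸-assoc 1 i≤n)))
             (cong (F (suc n)) (ℕ.n∸n≡0 n)))

conv-comm : ∀ n (F : ℕ → ℕ → ℚ) → conv n F ≡ conv n (λ i j → F j i)
conv-comm zero    F = refl
conv-comm (suc n) F = begin
  F 0 (suc n) + conv n (λ i j → F (suc i) j)   ≡⟨ cong (F 0 (suc n) +_) (conv-comm n (F ∘ suc)) ⟩
  F 0 (suc n) + conv n (λ i j → F (suc j) i)   ≡⟨ +-comm (F 0 (suc n)) _ ⟩
  conv n (λ i j → F (suc j) i) + F 0 (suc n)   ≡⟨ conv-last n (λ i j → F j i) ⟨
  conv (suc n) (λ i j → F j i)                  ∎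
  where open ≡-Reasoning

conv-assoc : ∀ n (F : ℕ → ℕ → ℕ → ℚ) →
  conv n (λ m k → conv m (λ i j → F i j k)) ≡ conv n (λ i s → conv s (F i))
conv-assoc zero    F = refl
conv-assoc (suc n) F = begin
  F 0 0 (suc n) + conv n (λ m k → F 0 (suc m) k + conv m (λ i j → F (suc i) j k))
    ≡⟨ cong (F 0 0 (suc n) +_) (conv-+ n (λ m k → F 0 (suc m) k) (λ m k → conv m (λ i j → F (suc i) j k))) ⟩
  F 0 0 (suc n) + (conv n (λ m k → F 0 (suc m) k) + conv n (λ m k → conv m (λ i j → F (suc i) j k)))
    ≡⟨ cong (λ z → F 0 0 (suc n) + (conv n (λ m k → F 0 (suc m) k) + z)) (conv-assoc n (F ∘ suc)) ⟩
  F 0 0 (suc n) + (conv n (λ m k → F 0 (suc m) k) + conv n (λ i s → conv s (F (suc i))))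
    ≡⟨ +-assoc (F 0 0 (suc n)) _ _ ⟨
  conv (suc n) (λ i s → conv s (F i)) ∎
  where open ≡-Reasoning

conv-end : ∀ n (F : ℕ → ℕ → ℚ) → (∀ i j → F i (suc j) ≡ 0ℚ) → conv n F ≡ F n 0
conv-end zero    F F≡0 = refl
conv-end (suc n) F F≡0 = trans (cong₂ _+_ (F≡0 0 n) (conv-end n (F ∘ suc) (F≡0 ∘ suc))) (+-identityˡ _)

conv-start : ∀ n (F : ℕ → ℕ → ℚ) → (∀ i j → F (suc i) j ≡ 0ℚ) → conv n F ≡ F 0 n
conv-start n F F≡0 = trans (conv-comm n F) (conv-end n (λ i j → F j i) (λ i j → F≡0 j i))

conv₄ : ℕ → (ℕ → ℕ → ℕ → ℕ → ℚ) → ℚ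
conv₄ n K = conv n (λ m s → conv m (λ i p → conv s (K i p)))

conv₄-+ : ∀ n (K K′ : ℕ → ℕ → ℕ → ℕ → ℚ) →
  conv₄ n (λ i p j q → K i p j q + K′ i p j q) ≡ conv₄ n K + conv₄ n K′
conv₄-+ n K K′ = trans
  (conv-cong n (λ m s _ → trans (conv-cong m (λ i p _ → conv-+ s (K i p) (K′ i p)))
                                (conv-+ m (λ i p → conv s (K i p)) (λ i p → conv s (K′ i p)))))
  (conv-+ n (λ m s → conv m (λ i p → conv s (K i p))) (λ m s → conv m (λ i p → conv s (K′ i p))))

conv₄-by-j : ∀ n (K : ℕ → ℕ → ℕ → ℕ → ℚ) →
  conv₄ n K ≡ conv n (λ j t → conv t (λ m q → conv m (λ i p → K i p j q)))
conv₄-by-j n K = sym (begin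
  conv n (λ j t → conv t (λ m q → Y j m q))
    ≡⟨ conv-assoc n Y ⟨
  conv n (λ r q → conv r (λ j m → Y j m q))
    ≡⟨ conv-cong n (λ r q _ → conv-comm r (λ j m → Y j m q)) ⟩
  conv n (λ r q → conv r (λ m j → Y j m q))
    ≡⟨ conv-assoc n (λ m j q → Y j m q) ⟩
  conv n (λ m s → conv s (λ j q → Y j m q))
    ≡⟨ conv-cong n (λ m s _ → sumTo-swap s m (λ j i → K i (m ∸ i) j (s ∸ j))) ⟩
  conv₄ n K ∎)
  where
  open ≡-Reasoning
  Y : ℕ → ℕ → ℕ → ℚ
  Y j m q = conv m (λ i p → K i p j q)

conv₄-by-ij : ∀ n (K : ℕ → ℕ → ℕ → ℕ → ℚ) →
  conv₄ n K ≡ conv n (λ k t → conv k (λ i j → conv t (λ p q → K i p j q)))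
conv₄-by-ij n K = begin
  conv₄ n K
    ≡⟨ conv-assoc n (λ i p s → conv s (K i p)) ⟩
  conv n (λ i r → conv r (λ p s → conv s (λ j q → K i p j q)))
    ≡⟨ conv-cong n (λ i r _ → swap-pj i r) ⟩
  conv n (λ i r → conv r (λ j s → conv s (λ p q → K i p j q)))
    ≡⟨ conv-assoc n (λ i j s → conv s (λ p q → K i p j q)) ⟨
  conv n (λ k t → conv k (λ i j → conv t (λ p q → K i p j q))) ∎
  where
  open ≡-Reasoning
  swap-pj : ∀ i r → conv r (λ p s → conv s (λ j q → K i p j q)) ≡ conv r (λ j s → conv s (λ p q → K i p j q))
  swap-pj i r = begin
    conv r (λ p s → conv s (λ j q → K i p j q)) ≡⟨ conv-assoc r (λ p j q → K i p j q) ⟨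
    conv r (λ l q → conv l (λ p j → K i p j q)) ≡⟨ conv-cong r (λ l q _ → conv-comm l (λ p j → K i p j q)) ⟩
    conv r (λ l q → conv l (λ j p → K i p j q)) ≡⟨ conv-assoc r (λ j p q → K i p j q) ⟩
    conv r (λ j s → conv s (λ p q → K i p j q)) ∎

sumList : List A → (A → ℚ) → ℚ
sumList []      g = 0ℚ
sumList (a ∷ l) g = g a + sumList l g

sumList-++ : ∀ (l l′ : List A) g → sumList (l ++ l′) g ≡ sumList l g + sumList l′ g
sumList-++ []      l′ g = sym (+-identityˡ _)
sumList-++ (a ∷ l) l′ g = trans (cong (g a +_) (sumList-++ l l′ g)) (sym (+-assoc (g a) _ _))

sumList-map : ∀ (f : A → B) l g → sumList (map f l) g ≡ sumList l (g ∘ f)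
sumList-map f []      g = refl
sumList-map f (a ∷ l) g = cong (g (f a) +_) (sumList-map f l g)

sumList-concatMap : ∀ (f : A → List B) l g → sumList (concatMap f l) g ≡ sumList l (λ a → sumList (f a) g)
sumList-concatMap f []      g = refl
sumList-concatMap f (a ∷ l) g = trans (sumList-++ (f a) (concatMap f l) g)
                                      (cong (sumList (f a) g +_) (sumList-concatMap f l g))

sumList-applyUpTo : ∀ (f : ℕ → A) n g → sumList (applyUpTo f (suc n)) g ≡ sumTo n (g ∘ f)
sumList-applyUpTo f zero    g = +-identityʳ _
sumList-applyUpTo f (suc n) g = cong (g (f 0) +_) (sumList-applyUpTo (f ∘ suc) n g)

sumList-cong : ∀ (l : List A) {g h} → (∀ a → g a ≡ h a) → sumList l g ≡ sumList l h
sumList-cong []      eq = refl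
sumList-cong (a ∷ l) eq = cong₂ _+_ (eq a) (sumList-cong l eq)

sumList-congᴬ : ∀ {P : A → Set} {l g h} → All P l → (∀ {a} → P a → g a ≡ h a) → sumList l g ≡ sumList l h
sumList-congᴬ []         eq = refl
sumList-congᴬ (pa ∷ pl) eq = cong₂ _+_ (eq pa) (sumList-congᴬ pl eq)

sumList-+ : ∀ (l : List A) g h → sumList l (λ a → g a + h a) ≡ sumList l g + sumList l h
sumList-+ []      g h = sym (+-identityˡ 0ℚ)
sumList-+ (a ∷ l) g h = trans (cong (g a + h a +_) (sumList-+ l g h))
                              (+-interchange (g a) (h a) (sumList l g) (sumList l h))

sumList-* : ∀ (l : List A) c g → sumList l (λ a → c * g a) ≡ c * sumList l g
sumList-* []      c g = sym (*-zeroʳ c)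
sumList-* (a ∷ l) c g = trans (cong (c * g a +_) (sumList-* l c g)) (sym (*-distribˡ-+ c (g a) _))

sumList-zero : ∀ (l : List A) {g} → (∀ a → g a ≡ 0ℚ) → sumList l g ≡ 0ℚ
sumList-zero []      eq = refl
sumList-zero (a ∷ l) eq = trans (cong₂ _+_ (eq a) (sumList-zero l eq)) (+-identityˡ 0ℚ)

sumList-swap : ∀ (l : List A) (l′ : List B) (h : A → B → ℚ) →
  sumList l (λ a → sumList l′ (h a)) ≡ sumList l′ (λ b → sumList l (λ a → h a b))
sumList-swap []      l′ h = sym (sumList-zero l′ (λ b → refl))
sumList-swap (a ∷ l) l′ h = trans (cong (sumList l′ (h a) +_) (sumList-swap l l′ h))
                                  (sym (sumList-+ l′ (h a) _))

sumList-conv : ∀ (l : List A) n (h : A → ℕ → ℕ → ℚ) →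
  sumList l (λ a → conv n (h a)) ≡ conv n (λ i j → sumList l (λ a → h a i j))
sumList-conv []      n h = sym (sumTo-zero n (λ i → refl))
sumList-conv (a ∷ l) n h = trans (cong (conv n (h a) +_) (sumList-conv l n h))
                                 (sym (conv-+ n (h a) (λ i j → sumList l (λ a → h a i j))))

-- Pairing polynomials with test functions

pair : Poly → (Word → ℚ) → ℚ
pair p g = sumList p (λ t → proj₁ t * g (proj₂ t))

δ : Word → Word → ℚ
δ w u = if does (u ≟W w) then 1ℚ else 0ℚ

coeff≡pair-δ : ∀ p w → coeff p w ≡ pair p (δ w)
coeff≡pair-δ []            w = refl
coeff≡pair-δ ((c , u) ∷ p) w with u ≟W w
... | yes _ = cong₂ _+_ (sym (*-identityʳ c)) (coeff≡pair-δ p w)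
... | no  _ = trans (coeff≡pair-δ p w) (sym (trans (cong (_+ _) (*-zeroʳ c)) (+-identityˡ _)))

pair-cong : ∀ p {g h} → (∀ u → g u ≡ h u) → pair p g ≡ pair p h
pair-cong p eq = sumList-cong p (λ t → cong (proj₁ t *_) (eq (proj₂ t)))

pair-congᴬ : ∀ {P : Word → Set} {p g h} → All (P ∘ proj₂) p → (∀ {u} → P u → g u ≡ h u) → pair p g ≡ pair p h
pair-congᴬ all eq = sumList-congᴬ all (λ {t} pa → cong (proj₁ t *_) (eq pa))

pair-+ : ∀ p g h → pair p (λ u → g u + h u) ≡ pair p g + pair p h
pair-+ p g h = trans (sumList-cong p (λ t → *-distribˡ-+ (proj₁ t) (g (proj₂ t)) (h (proj₂ t))))
                     (sumList-+ p _ _)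

pair-* : ∀ p c g → pair p (λ u → c * g u) ≡ c * pair p g
pair-* p c g = trans (sumList-cong p (λ t → *-exchangeˡ (proj₁ t) c (g (proj₂ t)))) (sumList-* p c _)

pair-zero : ∀ p {g} → (∀ u → g u ≡ 0ℚ) → pair p g ≡ 0ℚ
pair-zero p eq = sumList-zero p (λ t → trans (cong (proj₁ t *_) (eq (proj₂ t))) (*-zeroʳ (proj₁ t)))

pair-conv : ∀ p n (h : Word → ℕ → ℕ → ℚ) → pair p (λ u → conv n (h u)) ≡ conv n (λ i j → pair p (λ u → h u i j))
pair-conv p n h = trans (sumList-cong p (λ t → sym (conv-* n (proj₁ t) (h (proj₂ t)))))
                        (sumList-conv p n (λ t i j → proj₁ t * h (proj₂ t) i j))

pair-swap : ∀ p q (h : Word → Word → ℚ) → pair p (λ u → pair q (h u)) ≡ pair q (λ v → pair p (λ u → h u v))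
pair-swap p q h = trans (sumList-cong p (λ t → sym (pair-* q (proj₁ t) (h (proj₂ t)))))
  (trans (sumList-swap p q (λ t s → proj₁ s * (proj₁ t * h (proj₂ t) (proj₂ s))))
         (sumList-cong q (λ s → sumList-* p (proj₁ s) (λ t → proj₁ t * h (proj₂ t) (proj₂ s)))))

pair-scale : ∀ c p g → pair (scale c p) g ≡ c * pair p g
pair-scale c []            g = sym (*-zeroʳ c)
pair-scale c ((d , u) ∷ p) g = trans (cong₂ _+_ (*-assoc c d (g u)) (pair-scale c p g))
                                     (sym (*-distribˡ-+ c _ _))

pair-prefix : ∀ v p g → pair (prefix v p) g ≡ pair p (g ∘ (v ∷_))
pair-prefix v []            g = refl
pair-prefix v ((d , u) ∷ p) g = cong (d * g (v ∷ u) +_) (pair-prefix v p g)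

pair-ofWords : ∀ L g → pair (ofWords L) g ≡ sumList L g
pair-ofWords []      g = refl
pair-ofWords (u ∷ L) g = cong₂ _+_ (*-identityˡ (g u)) (pair-ofWords L g)

pair-bilin : ∀ op p q g → pair (bilin op p q) g ≡ pair p (λ u → pair q (λ v → sumList (op u v) g))
pair-bilin op p q g = trans (sumList-concatMap _ p _) (sumList-cong p λ { (c , u) →
  trans (sumList-concatMap _ q _)
    (trans (sumList-cong q (λ { (d , v) →
              trans (pair-scale (c * d) (ofWords (op u v)) g)
                    (trans (cong ((c * d) *_) (pair-ofWords (op u v) g)) (*-assoc c d _)) }))
           (sumList-* q c (λ s → proj₁ s * sumList (op u (proj₂ s)) g))) })

pair-bilinS : ∀ op F G n g → pair (bilinS op F G n) g ≡ conv n (λ i j → pair (op (F i) (G j)) g)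
pair-bilinS op F G n g = trans (sumList-concatMap (λ i → op (F i) (G (n ∸ i))) (applyUpTo (λ i → i) (suc n)) _)
                               (sumList-applyUpTo (λ i → i) n (λ i → pair (op (F i) (G (n ∸ i))) g))

pair-αA : ∀ p n g → pair (αA p n) g ≡ pair p (λ u → pair (αW u n) g)
pair-αA p n g = trans (sumList-concatMap _ p _) (sumList-cong p λ { (c , u) → pair-scale c (αW u n) g })

pair-αW-∷ : ∀ v w n g → pair (αW (v ∷ w) n) g ≡ sign n * sumList (shW (replicate n x) w) (g ∘ (v ∷_))
pair-αW-∷ v w n g = trans (pair-prefix v (geomX n ⧢ ((1ℚ , w) ∷ [])) g)
  (trans (pair-bilin shW ((sign n , replicate n x) ∷ []) ((1ℚ , w) ∷ []) (g ∘ (v ∷_)))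
         (trans (+-identityʳ _) (cong (sign n *_) (trans (+-identityʳ _) (*-identityˡ _)))))

-- The harmonic product on words of 𝔥¹

zcons : ℕ → Word → Word
zcons m t = y ∷ replicate m x ++ t

zLetters : ℕ → Word → ZWord
zLetters n []      = n ∷ []
zLetters n (x ∷ w) = zLetters (suc n) w
zLetters n (y ∷ w) = n ∷ zLetters 0 w

toZ : Word → ZWord
toZ []      = []
toZ (x ∷ w) = []
toZ (y ∷ w) = zLetters 0 w

parseZ≡zLetters : ∀ n w → parseZ n w ≡ just (zLetters n w)
parseZ≡zLetters n []      = refl
parseZ≡zLetters n (x ∷ w) = parseZ≡zLetters (suc n) w
parseZ≡zLetters n (y ∷ w) = cong (mapMaybe (n ∷_)) (parseZ≡zLetters 0 w)

parseZ-replicate-x : ∀ n m t → parseZ n (replicate m x ++ t) ≡ parseZ (n +ℕ m) t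
parseZ-replicate-x n zero    t = cong (λ k → parseZ k t) (sym (ℕ.+-identityʳ n))
parseZ-replicate-x n (suc m) t = trans (parseZ-replicate-x (suc n) m t) (cong (λ k → parseZ k t) (sym (ℕ.+-suc n m)))

parse≡toZ : ∀ {u} → InH1Word u → parse u ≡ just (toZ u)
parse≡toZ h1-empty = refl
parse≡toZ (h1-y w) = parseZ≡zLetters 0 w

parse-zcons : ∀ m {t} → InH1Word t → parse (zcons m t) ≡ just (m ∷ toZ t)
parse-zcons m h1-empty = parseZ-replicate-x 0 m []
parse-zcons m (h1-y w) = trans (parseZ-replicate-x 0 m (y ∷ w)) (cong (mapMaybe (m ∷_)) (parseZ≡zLetters 0 w))

replicate-x-snoc : ∀ n (t : Word) → replicate (suc n) x ++ t ≡ replicate n x ++ x ∷ t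
replicate-x-snoc zero    t = refl
replicate-x-snoc (suc n) t = cong (x ∷_) (replicate-x-snoc n t)

unZ-zLetters : ∀ n w → unZ (zLetters n w) ≡ zcons n w
unZ-zLetters n []      = refl
unZ-zLetters n (x ∷ w) = trans (unZ-zLetters (suc n) w) (cong (y ∷_) (replicate-x-snoc n w))
unZ-zLetters n (y ∷ w) = cong (zcons n) (unZ-zLetters 0 w)

unZ-toZ : ∀ {u} → InH1Word u → unZ (toZ u) ≡ u
unZ-toZ h1-empty = refl
unZ-toZ (h1-y w) = unZ-zLetters 0 w

harW-parsed : ∀ u v {zu zv} → parse u ≡ just zu → parse v ≡ just zv → harW u v ≡ map unZ (harZ zu zv)
harW-parsed u v eu ev with parse u | parse v
harW-parsed u v refl refl | just _  | just _  = refl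
harW-parsed u v ()   ev   | nothing | _
harW-parsed u v eu   ()   | just _  | nothing

harW-toZ : ∀ {u v} → InH1Word u → InH1Word v → harW u v ≡ map unZ (harZ (toZ u) (toZ v))
harW-toZ {u} {v} hu hv = harW-parsed u v (parse≡toZ hu) (parse≡toZ hv)

harW-[]ˡ : ∀ {v} → InH1Word v → harW [] v ≡ v ∷ []
harW-[]ˡ hv = trans (harW-toZ h1-empty hv) (cong (_∷ []) (unZ-toZ hv))

harW-[]ʳ : ∀ {u} → InH1Word u → harW u [] ≡ u ∷ []
harW-[]ʳ {u} hu = trans (harW-toZ hu h1-empty) (trans (harZ-[]ʳ (toZ u)) (cong (_∷ []) (unZ-toZ hu)))
  where
  harZ-[]ʳ : ∀ zs → map unZ (harZ zs []) ≡ unZ zs ∷ []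
  harZ-[]ʳ []      = refl
  harZ-[]ʳ (_ ∷ _) = refl

map-unZ-∷ : ∀ m L → map unZ (map (m ∷_) L) ≡ map (zcons m) (map unZ L)
map-unZ-∷ m L = trans (sym (map-∘ L)) (map-∘ L)

harW-zcons : ∀ m k {t s} → InH1Word t → InH1Word s →
  harW (zcons m t) (zcons k s) ≡ map (zcons m) (harW t (zcons k s))
                              ++ map (zcons k) (harW (zcons m t) s)
                              ++ map (zcons (suc (m +ℕ k))) (harW t s)
harW-zcons m k {t} {s} ht hs = begin
  harW (zcons m t) (zcons k s)
    ≡⟨ harW-parsed (zcons m t) (zcons k s) (parse-zcons m ht) (parse-zcons k hs) ⟩
  map unZ (map (m ∷_) L₁ ++ map (k ∷_) L₂ ++ map (suc (m +ℕ k) ∷_) L₃)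
    ≡⟨ trans (map-++ unZ (map (m ∷_) L₁) _) (cong (map unZ (map (m ∷_) L₁) ++_) (map-++ unZ (map (k ∷_) L₂) _)) ⟩
  map unZ (map (m ∷_) L₁) ++ map unZ (map (k ∷_) L₂) ++ map unZ (map (suc (m +ℕ k) ∷_) L₃)
    ≡⟨ cong₂ _++_ (map-unZ-∷ m L₁) (cong₂ _++_ (map-unZ-∷ k L₂) (map-unZ-∷ (suc (m +ℕ k)) L₃)) ⟩
  map (zcons m) (map unZ L₁) ++ map (zcons k) (map unZ L₂) ++ map (zcons (suc (m +ℕ k))) (map unZ L₃)
    ≡⟨ cong₂ _++_ (cong (map (zcons m)) (harW-parsed t (zcons k s) (parse≡toZ ht) (parse-zcons k hs)))
         (cong₂ _++_ (cong (map (zcons k)) (harW-parsed (zcons m t) s (parse-zcons m ht) (parse≡toZ hs)))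
                     (cong (map (zcons (suc (m +ℕ k)))) (harW-toZ ht hs))) ⟨
  map (zcons m) (harW t (zcons k s)) ++ map (zcons k) (harW (zcons m t) s) ++ map (zcons (suc (m +ℕ k))) (harW t s) ∎
  where
  open ≡-Reasoning
  L₁ = harZ (toZ t) (k ∷ toZ s)
  L₂ = harZ (m ∷ toZ t) (toZ s)
  L₃ = harZ (toZ t) (toZ s)

harSum : Word → Word → (Word → ℚ) → ℚ
harSum u v g = sumList (harW u v) g

harSum-[]ˡ : ∀ {v} → InH1Word v → ∀ g → harSum [] v g ≡ g v
harSum-[]ˡ hv g = trans (cong (λ L → sumList L g) (harW-[]ˡ hv)) (+-identityʳ _)

harSum-[]ʳ : ∀ {u} → InH1Word u → ∀ g → harSum u [] g ≡ g u
harSum-[]ʳ hu g = trans (cong (λ L → sumList L g) (harW-[]ʳ hu)) (+-identityʳ _)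

harSum-zcons : ∀ m k {t s} → InH1Word t → InH1Word s → ∀ g →
  harSum (zcons m t) (zcons k s) g ≡ harSum t (zcons k s) (g ∘ zcons m)
                                     + (harSum (zcons m t) s (g ∘ zcons k)
                                     + harSum t s (g ∘ zcons (suc (m +ℕ k))))
harSum-zcons m k {t} {s} ht hs g = begin
  sumList (harW (zcons m t) (zcons k s)) g
    ≡⟨ cong (λ L → sumList L g) (harW-zcons m k ht hs) ⟩
  sumList (map (zcons m) L₁ ++ map (zcons k) L₂ ++ map (zcons (suc (m +ℕ k))) L₃) g
    ≡⟨ trans (sumList-++ (map (zcons m) L₁) _ g) (cong (sumList (map (zcons m) L₁) g +_) (sumList-++ (map (zcons k) L₂) _ g)) ⟩
  sumList (map (zcons m) L₁) g + (sumList (map (zcons k) L₂) g + sumList (map (zcons (suc (m +ℕ k))) L₃) g)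
    ≡⟨ cong₂ _+_ (sumList-map (zcons m) L₁ g)
                 (cong₂ _+_ (sumList-map (zcons k) L₂ g) (sumList-map (zcons (suc (m +ℕ k))) L₃ g)) ⟩
  sumList L₁ (g ∘ zcons m) + (sumList L₂ (g ∘ zcons k) + sumList L₃ (g ∘ zcons (suc (m +ℕ k)))) ∎
  where
  open ≡-Reasoning
  L₁ = harW t (zcons k s)
  L₂ = harW (zcons m t) s
  L₃ = harW t s

-- α_A on z-words

-- binom a i = C(a + i, i), built from the hockey-stick identity
binom : ℕ → ℕ → ℚ
binom zero    i = 1ℚ
binom (suc a) i = sumTo i (binom a)

binom-zero : ∀ a → binom a 0 ≡ 1ℚ
binom-zero zero    = refl
binom-zero (suc a) = binom-zero a

binom-pascal : ∀ a i → binom (suc a) (suc i) ≡ binom (suc a) i + binom a (suc i)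
binom-pascal a i = sumTo-last i (binom a)

binom-vandermonde : ∀ a b k → conv k (λ i j → binom a i * binom b j) ≡ binom (suc (a +ℕ b)) k
binom-vandermonde zero    b k = trans (conv-cong k (λ i j _ → *-identityˡ (binom b j))) (conv-comm k (λ i j → binom b j))
binom-vandermonde (suc a) b k = begin
  conv k (λ i j → binom (suc a) i * binom b j)
    ≡⟨ conv-cong k (λ i j _ → sumTo-*ʳ i (binom a) (binom b j)) ⟩
  conv k (λ i j → conv i (λ l m → binom a l * binom b j))
    ≡⟨ conv-assoc k (λ l m j → binom a l * binom b j) ⟩
  conv k (λ l s → conv s (λ m j → binom a l * binom b j))
    ≡⟨ conv-cong k (λ l s _ → trans (conv-* s (binom a l) (λ m j → binom b j))
                                    (cong (binom a l *_) (conv-comm s (λ m j → binom b j)))) ⟩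
  conv k (λ l s → binom a l * binom (suc b) s)
    ≡⟨ binom-vandermonde a (suc b) k ⟩
  binom (suc (a +ℕ suc b)) k
    ≡⟨ cong (λ c → binom (suc c) k) (ℕ.+-suc a b) ⟩
  binom (suc (suc a +ℕ b)) k ∎
  where open ≡-Reasoning

sign-+ : ∀ i j → sign (i +ℕ j) ≡ sign i * sign j
sign-+ zero    j = sym (*-identityˡ _)
sign-+ (suc i) j = trans (cong -_ (sign-+ i j)) (neg-distribˡ-* (sign i) (sign j))

-- the coefficient of Aⁱ in (1 + A)^-(a+1)
negBinom : ℕ → ℕ → ℚ
negBinom a i = sign i * binom a i

negBinom-vandermonde : ∀ a b k → conv k (λ i j → negBinom a i * negBinom b j) ≡ negBinom (suc (a +ℕ b)) k
negBinom-vandermonde a b k = begin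
  conv k (λ i j → negBinom a i * negBinom b j)
    ≡⟨ conv-cong k (λ i j i+j≡k → trans (*-interchange (sign i) (binom a i) (sign j) (binom b j))
                                        (cong (_* (binom a i * binom b j)) (trans (sym (sign-+ i j)) (cong sign i+j≡k)))) ⟩
  conv k (λ i j → sign k * (binom a i * binom b j))
    ≡⟨ conv-* k (sign k) (λ i j → binom a i * binom b j) ⟩
  sign k * conv k (λ i j → binom a i * binom b j)
    ≡⟨ cong (sign k *_) (binom-vandermonde a b k) ⟩
  negBinom (suc (a +ℕ b)) k ∎
  where open ≡-Reasoning

replicate-x-+-suc : ∀ a i → replicate (a +ℕ suc i) x ≡ x ∷ replicate (a +ℕ i) x
replicate-x-+-suc a i = cong (λ k → replicate k x) (ℕ.+-suc a i)

sumList-shW-xⁿ-xᵃ : ∀ n a (f : Word → ℚ) →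
  sumList (shW (replicate n x) (replicate a x)) f ≡ binom a n * f (replicate (a +ℕ n) x)
sumList-shW-xⁿ-xᵃ zero a f = trans (+-identityʳ (f (replicate a x)))
  (sym (trans (cong₂ _*_ (binom-zero a) (cong (λ k → f (replicate k x)) (ℕ.+-identityʳ a)))
              (*-identityˡ (f (replicate a x)))))
sumList-shW-xⁿ-xᵃ (suc n) zero f = trans (+-identityʳ (f (x ∷ replicate n x))) (sym (*-identityˡ (f (x ∷ replicate n x))))
sumList-shW-xⁿ-xᵃ (suc n) (suc a) f = begin
  sumList (map (x ∷_) L₁ ++ map (x ∷_) L₂) f
    ≡⟨ sumList-++ (map (x ∷_) L₁) (map (x ∷_) L₂) f ⟩
  sumList (map (x ∷_) L₁) f + sumList (map (x ∷_) L₂) f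
    ≡⟨ cong₂ _+_ (sumList-map (x ∷_) L₁ f) (sumList-map (x ∷_) L₂ f) ⟩
  sumList L₁ (f ∘ (x ∷_)) + sumList L₂ (f ∘ (x ∷_))
    ≡⟨ cong₂ _+_ (sumList-shW-xⁿ-xᵃ n (suc a) (f ∘ (x ∷_))) (sumList-shW-xⁿ-xᵃ (suc n) a (f ∘ (x ∷_))) ⟩
  binom (suc a) n * f (x ∷ x ∷ replicate (a +ℕ n) x) + binom a (suc n) * f (x ∷ replicate (a +ℕ suc n) x)
    ≡⟨ cong (λ w → binom (suc a) n * f (x ∷ w) + binom a (suc n) * f xs) (replicate-x-+-suc a n) ⟨
  binom (suc a) n * f xs + binom a (suc n) * f xs
    ≡⟨ *-distribʳ-+ (f xs) (binom (suc a) n) (binom a (suc n)) ⟨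
  (binom (suc a) n + binom a (suc n)) * f xs
    ≡⟨ cong (_* f xs) (binom-pascal a n) ⟨
  binom (suc a) (suc n) * f xs ∎
  where
  open ≡-Reasoning
  L₁ = shW (replicate n x) (x ∷ replicate a x)
  L₂ = shW (x ∷ replicate n x) (replicate a x)
  xs = x ∷ replicate (a +ℕ suc n) x

-- x^n ⧢ x^a y r = Σ_{i ≤ n} C(a + i, i) x^(a+i) y (x^(n-i) ⧢ r); this is the i-th term tested against f.
shuffleXTerm : ℕ → ℕ → Word → (Word → ℚ) → ℕ → ℚ
shuffleXTerm n a r f i = binom a i * sumList (shW (replicate (n ∸ i) x) r) (λ w → f (replicate (a +ℕ i) x ++ y ∷ w))

sumList-shW-xⁿ-xᵃyr : ∀ n a r (f : Word → ℚ) →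
  sumList (shW (replicate n x) (replicate a x ++ y ∷ r)) f ≡ sumTo n (shuffleXTerm n a r f)
sumList-shW-xⁿ-xᵃyr zero a r f = trans (+-identityʳ (f (replicate a x ++ y ∷ r)))
  (sym (trans (cong₂ _*_ (binom-zero a) (cong (λ k → f (replicate k x ++ y ∷ r) + 0ℚ) (ℕ.+-identityʳ a)))
              (trans (*-identityˡ _) (+-identityʳ (f (replicate a x ++ y ∷ r))))))
sumList-shW-xⁿ-xᵃyr (suc n) zero r f = begin
  sumList (map (x ∷_) L₁ ++ map (y ∷_) L₂) f
    ≡⟨ sumList-++ (map (x ∷_) L₁) (map (y ∷_) L₂) f ⟩
  sumList (map (x ∷_) L₁) f + sumList (map (y ∷_) L₂) f
    ≡⟨ cong₂ _+_ (sumList-map (x ∷_) L₁ f) (sumList-map (y ∷_) L₂ f) ⟩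
  sumList L₁ (f ∘ (x ∷_)) + sumList L₂ (f ∘ (y ∷_))
    ≡⟨ cong (_+ sumList L₂ (f ∘ (y ∷_))) (sumList-shW-xⁿ-xᵃyr n zero r (f ∘ (x ∷_))) ⟩
  sumTo n (shuffleXTerm n zero r (f ∘ (x ∷_))) + sumList L₂ (f ∘ (y ∷_))
    ≡⟨ +-comm (sumTo n (shuffleXTerm n zero r (f ∘ (x ∷_)))) _ ⟩
  sumList L₂ (f ∘ (y ∷_)) + sumTo n (shuffleXTerm n zero r (f ∘ (x ∷_)))
    ≡⟨ cong (_+ sumTo n (shuffleXTerm n zero r (f ∘ (x ∷_)))) (*-identityˡ (sumList L₂ (f ∘ (y ∷_)))) ⟨
  sumTo (suc n) (shuffleXTerm (suc n) zero r f) ∎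
  where
  open ≡-Reasoning
  L₁ = shW (replicate n x) (y ∷ r)
  L₂ = shW (x ∷ replicate n x) r
sumList-shW-xⁿ-xᵃyr (suc n) (suc a) r f = begin
  sumList (map (x ∷_) L₁ ++ map (x ∷_) L₂) f
    ≡⟨ sumList-++ (map (x ∷_) L₁) (map (x ∷_) L₂) f ⟩
  sumList (map (x ∷_) L₁) f + sumList (map (x ∷_) L₂) f
    ≡⟨ cong₂ _+_ (sumList-map (x ∷_) L₁ f) (sumList-map (x ∷_) L₂ f) ⟩
  sumList L₁ (f ∘ (x ∷_)) + sumList L₂ (f ∘ (x ∷_))
    ≡⟨ cong₂ _+_ (sumList-shW-xⁿ-xᵃyr n (suc a) r (f ∘ (x ∷_))) (sumList-shW-xⁿ-xᵃyr (suc n) a r (f ∘ (x ∷_))) ⟩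
  sumTo n (shuffleXTerm n (suc a) r (f ∘ (x ∷_))) + (T₀ + sumTo n (λ i → binom a (suc i) * T i))
    ≡⟨ cong (_+ (T₀ + sumTo n (λ i → binom a (suc i) * T i)))
            (sumTo-cong n (λ i → cong (binom (suc a) i *_) (sumList-cong (shW (replicate (n ∸ i) x) r)
              (λ w → cong (λ xs → f (x ∷ xs ++ y ∷ w)) (sym (replicate-x-+-suc a i)))))) ⟩
  sumTo n (λ i → binom (suc a) i * T i) + (T₀ + sumTo n (λ i → binom a (suc i) * T i))
    ≡⟨ +-exchangeˡ (sumTo n (λ i → binom (suc a) i * T i)) T₀ _ ⟩
  T₀ + (sumTo n (λ i → binom (suc a) i * T i) + sumTo n (λ i → binom a (suc i) * T i))
    ≡⟨ cong (T₀ +_) (sumTo-+ n (λ i → binom (suc a) i * T i) (λ i → binom a (suc i) * T i)) ⟨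
  T₀ + sumTo n (λ i → binom (suc a) i * T i + binom a (suc i) * T i)
    ≡⟨ cong (T₀ +_) (sumTo-cong n (λ i → trans (sym (*-distribʳ-+ (T i) (binom (suc a) i) (binom a (suc i))))
                                               (cong (_* T i) (sym (binom-pascal a i))))) ⟩
  sumTo (suc n) (shuffleXTerm (suc n) (suc a) r f) ∎
  where
  open ≡-Reasoning
  L₁ = shW (replicate n x) (x ∷ (replicate a x ++ y ∷ r))
  L₂ = shW (x ∷ replicate n x) (replicate a x ++ y ∷ r)
  T : ℕ → ℚ
  T i = sumList (shW (replicate (n ∸ i) x) r) (λ w → f (x ∷ (replicate (a +ℕ suc i) x ++ y ∷ w)))
  T₀ = binom a 0 * sumList (shW (x ∷ replicate n x) r) (λ w → f (x ∷ (replicate (a +ℕ 0) x ++ y ∷ w)))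

αZ : ZWord → Series
αZ zs = αW (unZ zs)

αZ-inH1 : ∀ zs n → All (InH1Word ∘ proj₂) (αZ zs n)
αZ-inH1 []      zero    = h1-empty ∷ []
αZ-inH1 []      (suc n) = []
αZ-inH1 (a ∷ zs) n      = prefix-y-inH1 _
  where
  prefix-y-inH1 : ∀ p → All (InH1Word ∘ proj₂) (prefix y p)
  prefix-y-inH1 []            = []
  prefix-y-inH1 ((c , u) ∷ p) = h1-y u ∷ prefix-y-inH1 p

pair-αZ-[]-0 : ∀ g → pair (αZ [] 0) g ≡ g []
pair-αZ-[]-0 g = trans (+-identityʳ _) (*-identityˡ (g []))

pair-αZ-∷ : ∀ a zs n g → pair (αZ (a ∷ zs) n) g ≡ conv n (λ i j → negBinom a i * pair (αZ zs j) (g ∘ zcons (a +ℕ i)))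
pair-αZ-∷ a [] n g = begin
  pair (αW (zcons a []) n) g
    ≡⟨ pair-αW-∷ y (replicate a x ++ []) n g ⟩
  sign n * sumList (shW (replicate n x) (replicate a x ++ [])) (g ∘ (y ∷_))
    ≡⟨ cong (λ w → sign n * sumList (shW (replicate n x) w) (g ∘ (y ∷_))) (++-identityʳ (replicate a x)) ⟩
  sign n * sumList (shW (replicate n x) (replicate a x)) (g ∘ (y ∷_))
    ≡⟨ cong (sign n *_) (sumList-shW-xⁿ-xᵃ n a (g ∘ (y ∷_))) ⟩
  sign n * (binom a n * g (y ∷ replicate (a +ℕ n) x))
    ≡⟨ *-assoc (sign n) (binom a n) _ ⟨
  negBinom a n * g (y ∷ replicate (a +ℕ n) x)
    ≡⟨ cong (λ w → negBinom a n * g (y ∷ w)) (++-identityʳ (replicate (a +ℕ n) x)) ⟨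
  negBinom a n * g (zcons (a +ℕ n) [])
    ≡⟨ cong (negBinom a n *_) (pair-αZ-[]-0 (g ∘ zcons (a +ℕ n))) ⟨
  negBinom a n * pair (αZ [] 0) (g ∘ zcons (a +ℕ n))
    ≡⟨ conv-end n (λ i j → negBinom a i * pair (αZ [] j) (g ∘ zcons (a +ℕ i))) (λ i j → *-zeroʳ (negBinom a i)) ⟨
  conv n (λ i j → negBinom a i * pair (αZ [] j) (g ∘ zcons (a +ℕ i))) ∎
  where open ≡-Reasoning
pair-αZ-∷ a (b ∷ zs) n g = begin
  pair (αW (zcons a r′) n) g
    ≡⟨ pair-αW-∷ y (replicate a x ++ r′) n g ⟩
  sign n * sumList (shW (replicate n x) (replicate a x ++ y ∷ r)) (g ∘ (y ∷_))
    ≡⟨ cong (sign n *_) (sumList-shW-xⁿ-xᵃyr n a r (g ∘ (y ∷_))) ⟩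
  sign n * sumTo n (shuffleXTerm n a r (g ∘ (y ∷_)))
    ≡⟨ sumTo-*ˡ n (sign n) (shuffleXTerm n a r (g ∘ (y ∷_))) ⟨
  conv n (λ i j → sign n * (binom a i * S i j))
    ≡⟨ conv-cong n (λ i j i+j≡n → trans (cong (λ k → sign k * (binom a i * S i j)) (sym i+j≡n))
            (trans (cong (_* (binom a i * S i j)) (sign-+ i j)) (*-interchange (sign i) (sign j) (binom a i) (S i j)))) ⟩
  conv n (λ i j → negBinom a i * (sign j * S i j))
    ≡⟨ conv-cong n (λ i j _ → cong (negBinom a i *_) (sym (pair-αW-∷ y r j (g ∘ zcons (a +ℕ i))))) ⟩
  conv n (λ i j → negBinom a i * pair (αZ (b ∷ zs) j) (g ∘ zcons (a +ℕ i))) ∎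
  where
  open ≡-Reasoning
  r = replicate b x ++ unZ zs
  r′ = y ∷ r
  S : ℕ → ℕ → ℚ
  S i j = sumList (shW (replicate j x) r) (λ w → g (y ∷ (replicate (a +ℕ i) x ++ y ∷ w)))

-- The induction on the harmonic product

αProduct : Word → Word → ℕ → (Word → ℚ) → ℚ
αProduct u v n g = conv n (λ i j → pair (αW u i) (λ u′ → pair (αW v j) (λ v′ → harSum u′ v′ g)))

sumList-map-∷-αZ : ∀ a L n g → sumList (map (a ∷_) L) (λ w → pair (αZ w n) g)
                              ≡ conv n (λ i j → negBinom a i * sumList L (λ w → pair (αZ w j) (g ∘ zcons (a +ℕ i))))
sumList-map-∷-αZ a L n g = begin
  sumList (map (a ∷_) L) (λ w → pair (αZ w n) g)
    ≡⟨ sumList-map (a ∷_) L (λ w → pair (αZ w n) g) ⟩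
  sumList L (λ w → pair (αZ (a ∷ w) n) g)
    ≡⟨ sumList-cong L (λ w → pair-αZ-∷ a w n g) ⟩
  sumList L (λ w → conv n (λ i j → negBinom a i * pair (αZ w j) (g ∘ zcons (a +ℕ i))))
    ≡⟨ sumList-conv L n (λ w i j → negBinom a i * pair (αZ w j) (g ∘ zcons (a +ℕ i))) ⟩
  conv n (λ i j → sumList L (λ w → negBinom a i * pair (αZ w j) (g ∘ zcons (a +ℕ i))))
    ≡⟨ conv-cong n (λ i j _ → sumList-* L (negBinom a i) (λ w → pair (αZ w j) (g ∘ zcons (a +ℕ i)))) ⟩
  conv n (λ i j → negBinom a i * sumList L (λ w → pair (αZ w j) (g ∘ zcons (a +ℕ i)))) ∎
  where open ≡-Reasoning

module HarmonicStep (a b : ℕ) (u v : ZWord) (g : Word → ℚ) where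

  Kernel : Set
  Kernel = ℕ → ℕ → Word → Word → ℚ

  weigh : Kernel → ℕ → ℕ → ℕ → ℕ → ℚ
  weigh T i p j q = negBinom a i * (negBinom b j * pair (αZ u p) (λ u′ → pair (αZ v q) (T i j u′)))

  weigh-+ : ∀ T T′ i p j q →
    weigh (λ i j u′ v′ → T i j u′ v′ + T′ i j u′ v′) i p j q ≡ weigh T i p j q + weigh T′ i p j q
  weigh-+ T T′ i p j q = begin
    negBinom a i * (negBinom b j * pair (αZ u p) (λ u′ → pair (αZ v q) (λ v′ → T i j u′ v′ + T′ i j u′ v′)))
      ≡⟨ cong (λ z → negBinom a i * (negBinom b j * z))
              (trans (pair-cong (αZ u p) (λ u′ → pair-+ (αZ v q) (T i j u′) (T′ i j u′)))
                     (pair-+ (αZ u p) (λ u′ → pair (αZ v q) (T i j u′)) (λ u′ → pair (αZ v q) (T′ i j u′)))) ⟩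
    negBinom a i * (negBinom b j * (P + P′))
      ≡⟨ cong (negBinom a i *_) (*-distribˡ-+ (negBinom b j) P P′) ⟩
    negBinom a i * (negBinom b j * P + negBinom b j * P′)
      ≡⟨ *-distribˡ-+ (negBinom a i) (negBinom b j * P) (negBinom b j * P′) ⟩
    weigh T i p j q + weigh T′ i p j q ∎
    where
    open ≡-Reasoning
    P  = pair (αZ u p) (λ u′ → pair (αZ v q) (T i j u′))
    P′ = pair (αZ u p) (λ u′ → pair (αZ v q) (T′ i j u′))

  -- The three terms z_k(w₁ * z_l w₂), z_l(z_k w₁ * w₂), z_(k+l)(w₁ * w₂) with k = a+i+1, l = b+j+1.
  kernelₖ kernelₗ kernelₖ₊ₗ : Kernel
  kernelₖ   i j u′ v′ = harSum u′ (zcons (b +ℕ j) v′) (g ∘ zcons (a +ℕ i))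
  kernelₗ   i j u′ v′ = harSum (zcons (a +ℕ i) u′) v′ (g ∘ zcons (b +ℕ j))
  kernelₖ₊ₗ i j u′ v′ = harSum u′ v′ (g ∘ zcons (suc ((a +ℕ i) +ℕ (b +ℕ j))))

  scale-pair-conv : ∀ (P : Poly) c s (W : Word → ℕ → ℕ → ℚ) →
    c * pair P (λ u′ → conv s (λ j q → negBinom b j * W u′ j q))
      ≡ conv s (λ j q → c * (negBinom b j * pair P (λ u′ → W u′ j q)))
  scale-pair-conv P c s W = trans
    (cong (c *_) (trans (pair-conv P s (λ u′ j q → negBinom b j * W u′ j q))
                        (conv-cong s (λ j q _ → pair-* P (negBinom b j) (λ u′ → W u′ j q)))))
    (sym (conv-* s c (λ j q → negBinom b j * pair P (λ u′ → W u′ j q))))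

  pair-αZ-∷-αZ-∷ : ∀ m s (Φ : Word → Word → ℚ) →
    pair (αZ (a ∷ u) m) (λ u″ → pair (αZ (b ∷ v) s) (Φ u″))
      ≡ conv m (λ i p → conv s (λ j q → negBinom a i * (negBinom b j *
          pair (αZ u p) (λ u′ → pair (αZ v q) (λ v′ → Φ (zcons (a +ℕ i) u′) (zcons (b +ℕ j) v′))))))
  pair-αZ-∷-αZ-∷ m s Φ = trans (pair-αZ-∷ a u m (λ u″ → pair (αZ (b ∷ v) s) (Φ u″)))
    (conv-cong m (λ i p _ → trans
      (cong (negBinom a i *_) (pair-cong (αZ u p) (λ u′ → pair-αZ-∷ b v s (Φ (zcons (a +ℕ i) u′)))))
      (scale-pair-conv (αZ u p) (negBinom a i) s (λ u′ j q → pair (αZ v q) (λ v′ → Φ (zcons (a +ℕ i) u′) (zcons (b +ℕ j) v′))))))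

  αProduct-∷-∷ : ∀ n → αProduct (unZ (a ∷ u)) (unZ (b ∷ v)) n g
                     ≡ conv₄ n (weigh kernelₖ) + (conv₄ n (weigh kernelₗ) + conv₄ n (weigh kernelₖ₊ₗ))
  αProduct-∷-∷ n = begin
    αProduct (unZ (a ∷ u)) (unZ (b ∷ v)) n g
      ≡⟨ conv-cong n (λ m s _ → pair-αZ-∷-αZ-∷ m s (λ u″ v″ → harSum u″ v″ g)) ⟩
    conv₄ n (weigh (λ i j u′ v′ → harSum (zcons (a +ℕ i) u′) (zcons (b +ℕ j) v′) g))
      ≡⟨ conv-cong n (λ m s _ → conv-cong m (λ i p _ → conv-cong s (λ j q _ → split i p j q))) ⟩
    conv₄ n (λ i p j q → weigh kernelₖ i p j q + (weigh kernelₗ i p j q + weigh kernelₖ₊ₗ i p j q))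
      ≡⟨ conv₄-+ n (weigh kernelₖ) (λ i p j q → weigh kernelₗ i p j q + weigh kernelₖ₊ₗ i p j q) ⟩
    conv₄ n (weigh kernelₖ) + conv₄ n (λ i p j q → weigh kernelₗ i p j q + weigh kernelₖ₊ₗ i p j q)
      ≡⟨ cong (conv₄ n (weigh kernelₖ) +_) (conv₄-+ n (weigh kernelₗ) (weigh kernelₖ₊ₗ)) ⟩
    conv₄ n (weigh kernelₖ) + (conv₄ n (weigh kernelₗ) + conv₄ n (weigh kernelₖ₊ₗ)) ∎
    where
    open ≡-Reasoning
    split : ∀ i p j q → weigh (λ i j u′ v′ → harSum (zcons (a +ℕ i) u′) (zcons (b +ℕ j) v′) g) i p j q
                        ≡ weigh kernelₖ i p j q + (weigh kernelₗ i p j q + weigh kernelₖ₊ₗ i p j q)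
    split i p j q = begin
      weigh (λ i j u′ v′ → harSum (zcons (a +ℕ i) u′) (zcons (b +ℕ j) v′) g) i p j q
        ≡⟨ cong (λ z → negBinom a i * (negBinom b j * z))
                (pair-congᴬ (αZ-inH1 u p) (λ hu → pair-congᴬ (αZ-inH1 v q) (λ hv → harSum-zcons (a +ℕ i) (b +ℕ j) hu hv g))) ⟩
      weigh (λ i j u′ v′ → kernelₖ i j u′ v′ + (kernelₗ i j u′ v′ + kernelₖ₊ₗ i j u′ v′)) i p j q
        ≡⟨ weigh-+ kernelₖ (λ i j u′ v′ → kernelₗ i j u′ v′ + kernelₖ₊ₗ i j u′ v′) i p j q ⟩
      weigh kernelₖ i p j q + weigh (λ i j u′ v′ → kernelₗ i j u′ v′ + kernelₖ₊ₗ i j u′ v′) i p j q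
        ≡⟨ cong (weigh kernelₖ i p j q +_) (weigh-+ kernelₗ kernelₖ₊ₗ i p j q) ⟩
      weigh kernelₖ i p j q + (weigh kernelₗ i p j q + weigh kernelₖ₊ₗ i p j q) ∎

  zₖ-term : ∀ n → conv n (λ i t → negBinom a i * αProduct (unZ u) (unZ (b ∷ v)) t (g ∘ zcons (a +ℕ i)))
                  ≡ conv₄ n (weigh kernelₖ)
  zₖ-term n = begin
    conv n (λ i t → negBinom a i * αProduct (unZ u) (unZ (b ∷ v)) t (g ∘ zcons (a +ℕ i)))
      ≡⟨ conv-cong n (λ i t _ → trans (sym (conv-* t (negBinom a i) (X i))) (conv-cong t (λ p s _ → expand i p s))) ⟩
    conv n (λ i t → conv t (λ p s → conv s (weigh kernelₖ i p)))
      ≡⟨ conv-assoc n (λ i p s → conv s (weigh kernelₖ i p)) ⟨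
    conv₄ n (weigh kernelₖ) ∎
    where
    open ≡-Reasoning
    X : ℕ → ℕ → ℕ → ℚ
    X i p s = pair (αZ u p) (λ u′ → pair (αZ (b ∷ v) s) (λ v″ → harSum u′ v″ (g ∘ zcons (a +ℕ i))))
    expand : ∀ i p s → negBinom a i * X i p s ≡ conv s (weigh kernelₖ i p)
    expand i p s = trans
      (cong (negBinom a i *_) (pair-cong (αZ u p) (λ u′ → pair-αZ-∷ b v s (λ v″ → harSum u′ v″ (g ∘ zcons (a +ℕ i))))))
      (scale-pair-conv (αZ u p) (negBinom a i) s (λ u′ j q → pair (αZ v q) (kernelₖ i j u′)))

  zₗ-term : ∀ n → conv n (λ j t → negBinom b j * αProduct (unZ (a ∷ u)) (unZ v) t (g ∘ zcons (b +ℕ j)))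
                  ≡ conv₄ n (weigh kernelₗ)
  zₗ-term n = begin
    conv n (λ j t → negBinom b j * αProduct (unZ (a ∷ u)) (unZ v) t (g ∘ zcons (b +ℕ j)))
      ≡⟨ conv-cong n (λ j t _ → trans (sym (conv-* t (negBinom b j) (X j))) (conv-cong t (λ m q _ → expand j m q))) ⟩
    conv n (λ j t → conv t (λ m q → conv m (λ i p → weigh kernelₗ i p j q)))
      ≡⟨ conv₄-by-j n (weigh kernelₗ) ⟨
    conv₄ n (weigh kernelₗ) ∎
    where
    open ≡-Reasoning
    X : ℕ → ℕ → ℕ → ℚ
    X j m q = pair (αZ (a ∷ u) m) (λ u″ → pair (αZ v q) (λ v′ → harSum u″ v′ (g ∘ zcons (b +ℕ j))))
    Y : ℕ → ℕ → ℕ → ℕ → ℚ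
    Y j q i p = pair (αZ u p) (λ u′ → pair (αZ v q) (kernelₗ i j u′))
    expand : ∀ j m q → negBinom b j * X j m q ≡ conv m (λ i p → weigh kernelₗ i p j q)
    expand j m q = begin
      negBinom b j * X j m q
        ≡⟨ cong (negBinom b j *_) (pair-αZ-∷ a u m (λ u″ → pair (αZ v q) (λ v′ → harSum u″ v′ (g ∘ zcons (b +ℕ j))))) ⟩
      negBinom b j * conv m (λ i p → negBinom a i * Y j q i p)
        ≡⟨ conv-* m (negBinom b j) (λ i p → negBinom a i * Y j q i p) ⟨
      conv m (λ i p → negBinom b j * (negBinom a i * Y j q i p))
        ≡⟨ conv-cong m (λ i p _ → *-exchangeˡ (negBinom b j) (negBinom a i) (Y j q i p)) ⟩
      conv m (λ i p → weigh kernelₗ i p j q) ∎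

  zₖ₊ₗ-term : ∀ n →
    conv n (λ k t → negBinom (suc (a +ℕ b)) k * αProduct (unZ u) (unZ v) t (g ∘ zcons (suc (a +ℕ b) +ℕ k)))
                    ≡ conv₄ n (weigh kernelₖ₊ₗ)
  zₖ₊ₗ-term n = begin
    conv n (λ k t → negBinom (suc (a +ℕ b)) k * conv t (Z k))
      ≡⟨ conv-cong n (λ k t _ → split k t) ⟩
    conv n (λ k t → conv k (λ i j → conv t (λ p q → weigh kernelₖ₊ₗ i p j q)))
      ≡⟨ conv₄-by-ij n (weigh kernelₖ₊ₗ) ⟨
    conv₄ n (weigh kernelₖ₊ₗ) ∎
    where
    open ≡-Reasoning
    Z : ℕ → ℕ → ℕ → ℚ
    Z k p q = pair (αZ u p) (λ u′ → pair (αZ v q) (λ v′ → harSum u′ v′ (g ∘ zcons (suc (a +ℕ b) +ℕ k))))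
    reindex : ∀ k i j → i +ℕ j ≡ k → ∀ p q → (negBinom a i * negBinom b j) * Z k p q ≡ weigh kernelₖ₊ₗ i p j q
    reindex k i j i+j≡k p q = trans (*-assoc (negBinom a i) (negBinom b j) (Z k p q))
      (cong (λ c → negBinom a i * (negBinom b j * pair (αZ u p) (λ u′ → pair (αZ v q) (λ v′ → harSum u′ v′ (g ∘ zcons c)))))
            (cong suc (trans (cong ((a +ℕ b) +ℕ_) (sym i+j≡k)) (ℕ-+-interchange a b i j))))
    split : ∀ k t → negBinom (suc (a +ℕ b)) k * conv t (Z k) ≡ conv k (λ i j → conv t (λ p q → weigh kernelₖ₊ₗ i p j q))
    split k t = begin
      negBinom (suc (a +ℕ b)) k * conv t (Z k)
        ≡⟨ cong (_* conv t (Z k)) (negBinom-vandermonde a b k) ⟨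
      conv k (λ i j → negBinom a i * negBinom b j) * conv t (Z k)
        ≡⟨ sumTo-*ʳ k (λ i → negBinom a i * negBinom b (k ∸ i)) (conv t (Z k)) ⟩
      conv k (λ i j → (negBinom a i * negBinom b j) * conv t (Z k))
        ≡⟨ conv-cong k (λ i j i+j≡k → trans (sym (conv-* t (negBinom a i * negBinom b j) (Z k)))
                                            (conv-cong t (λ p q _ → reindex k i j i+j≡k p q))) ⟩
      conv k (λ i j → conv t (λ p q → weigh kernelₖ₊ₗ i p j q)) ∎

pair-α-harZ : ∀ zu zv n g → sumList (harZ zu zv) (λ w → pair (αZ w n) g) ≡ αProduct (unZ zu) (unZ zv) n g
pair-α-harZ [] zv n g = begin
  pair (αZ zv n) g + 0ℚ
    ≡⟨ +-identityʳ _ ⟩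
  pair (αZ zv n) g
    ≡⟨ pair-congᴬ (αZ-inH1 zv n) (λ hv → harSum-[]ˡ hv g) ⟨
  pair (αZ zv n) (λ v → harSum [] v g)
    ≡⟨ pair-αZ-[]-0 (λ u → pair (αZ zv n) (λ v → harSum u v g)) ⟨
  pair (αZ [] 0) (λ u → pair (αZ zv n) (λ v → harSum u v g))
    ≡⟨ conv-start n (λ i j → pair (αZ [] i) (λ u → pair (αZ zv j) (λ v → harSum u v g))) (λ i j → refl) ⟨
  αProduct [] (unZ zv) n g ∎
  where open ≡-Reasoning
pair-α-harZ (a ∷ u) [] n g = begin
  pair (αZ (a ∷ u) n) g + 0ℚ
    ≡⟨ +-identityʳ _ ⟩
  pair (αZ (a ∷ u) n) g
    ≡⟨ pair-congᴬ (αZ-inH1 (a ∷ u) n) (λ {u′} hu → trans (pair-αZ-[]-0 (λ v → harSum u′ v g)) (harSum-[]ʳ hu g)) ⟨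
  pair (αZ (a ∷ u) n) (λ u′ → pair (αZ [] 0) (λ v → harSum u′ v g))
    ≡⟨ conv-end n (λ i j → pair (αZ (a ∷ u) i) (λ u′ → pair (αZ [] j) (λ v → harSum u′ v g)))
                  (λ i j → pair-zero (αZ (a ∷ u) i) (λ _ → refl)) ⟨
  αProduct (unZ (a ∷ u)) [] n g ∎
  where open ≡-Reasoning
pair-α-harZ (a ∷ u) (b ∷ v) n g = begin
  sumList (map (a ∷_) L₁ ++ map (b ∷_) L₂ ++ map (c ∷_) L₃) G
    ≡⟨ trans (sumList-++ (map (a ∷_) L₁) _ G) (cong (sumList (map (a ∷_) L₁) G +_) (sumList-++ (map (b ∷_) L₂) _ G)) ⟩
  sumList (map (a ∷_) L₁) G + (sumList (map (b ∷_) L₂) G + sumList (map (c ∷_) L₃) G)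
    ≡⟨ cong₂ _+_ (sumList-map-∷-αZ a L₁ n g) (cong₂ _+_ (sumList-map-∷-αZ b L₂ n g) (sumList-map-∷-αZ c L₃ n g)) ⟩
  conv n (λ i t → negBinom a i * sumList L₁ (λ w → pair (αZ w t) (g ∘ zcons (a +ℕ i))))
   + (conv n (λ j t → negBinom b j * sumList L₂ (λ w → pair (αZ w t) (g ∘ zcons (b +ℕ j))))
   + conv n (λ k t → negBinom c k * sumList L₃ (λ w → pair (αZ w t) (g ∘ zcons (c +ℕ k)))))
    ≡⟨ cong₂ _+_ (conv-cong n (λ i t _ → cong (negBinom a i *_) (pair-α-harZ u (b ∷ v) t (g ∘ zcons (a +ℕ i)))))
        (cong₂ _+_ (conv-cong n (λ j t _ → cong (negBinom b j *_) (pair-α-harZ (a ∷ u) v t (g ∘ zcons (b +ℕ j)))))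
                   (conv-cong n (λ k t _ → cong (negBinom c k *_) (pair-α-harZ u v t (g ∘ zcons (c +ℕ k)))))) ⟩
  conv n (λ i t → negBinom a i * αProduct (unZ u) (unZ (b ∷ v)) t (g ∘ zcons (a +ℕ i)))
   + (conv n (λ j t → negBinom b j * αProduct (unZ (a ∷ u)) (unZ v) t (g ∘ zcons (b +ℕ j)))
   + conv n (λ k t → negBinom c k * αProduct (unZ u) (unZ v) t (g ∘ zcons (c +ℕ k))))
    ≡⟨ cong₂ _+_ (zₖ-term n) (cong₂ _+_ (zₗ-term n) (zₖ₊ₗ-term n)) ⟩
  conv₄ n (weigh kernelₖ) + (conv₄ n (weigh kernelₗ) + conv₄ n (weigh kernelₖ₊ₗ))
    ≡⟨ αProduct-∷-∷ n ⟨
  αProduct (unZ (a ∷ u)) (unZ (b ∷ v)) n g ∎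
  where
  open ≡-Reasoning
  open HarmonicStep a b u v g
  c = suc (a +ℕ b)
  L₁ = harZ u (b ∷ v)
  L₂ = harZ (a ∷ u) v
  L₃ = harZ u v
  G : ZWord → ℚ
  G w = pair (αZ w n) g

pair-α-harW : ∀ {u v} → InH1Word u → InH1Word v → ∀ n g →
  sumList (harW u v) (λ t → pair (αW t n) g) ≡ αProduct u v n g
pair-α-harW {u} {v} hu hv n g = begin
  sumList (harW u v) (λ t → pair (αW t n) g)
    ≡⟨ cong (λ L → sumList L (λ t → pair (αW t n) g)) (harW-toZ hu hv) ⟩
  sumList (map unZ (harZ (toZ u) (toZ v))) (λ t → pair (αW t n) g)
    ≡⟨ sumList-map unZ (harZ (toZ u) (toZ v)) (λ t → pair (αW t n) g) ⟩
  sumList (harZ (toZ u) (toZ v)) (λ w → pair (αZ w n) g)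
    ≡⟨ pair-α-harZ (toZ u) (toZ v) n g ⟩
  αProduct (unZ (toZ u)) (unZ (toZ v)) n g
    ≡⟨ cong₂ (λ u′ v′ → αProduct u′ v′ n g) (unZ-toZ hu) (unZ-toZ hv) ⟩
  αProduct u v n g ∎
  where open ≡-Reasoning

pair-αA-*h : ∀ p q n g → pair (αA (p *h q) n) g ≡ pair p (λ u → pair q (λ v → sumList (harW u v) (λ t → pair (αW t n) g)))
pair-αA-*h p q n g = trans (pair-αA (p *h q) n g) (pair-bilin harW p q (λ t → pair (αW t n) g))

pair-αA-*S-αA : ∀ p q n g → pair ((αA p *S αA q) n) g ≡ pair p (λ u → pair q (λ v → αProduct u v n g))
pair-αA-*S-αA p q n g = begin
  pair ((αA p *S αA q) n) g
    ≡⟨ pair-bilinS _*h_ (αA p) (αA q) n g ⟩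
  conv n (λ i j → pair (αA p i *h αA q j) g)
    ≡⟨ conv-cong n (λ i j _ → pair-bilin harW (αA p i) (αA q j) g) ⟩
  conv n (λ i j → pair (αA p i) (λ u′ → pair (αA q j) (λ v′ → harSum u′ v′ g)))
    ≡⟨ conv-cong n (λ i j _ → trans (pair-αA p i (λ u′ → pair (αA q j) (λ v′ → harSum u′ v′ g)))
                                    (pair-cong p (λ u → pair-cong (αW u i) (λ u′ → pair-αA q j (λ v′ → harSum u′ v′ g))))) ⟩
  conv n (λ i j → pair p (λ u → pair (αW u i) (λ u′ → pair q (λ v → K v j u′))))
    ≡⟨ conv-cong n (λ i j _ → pair-cong p (λ u → pair-swap (αW u i) q (λ u′ v → K v j u′))) ⟩
  conv n (λ i j → pair p (λ u → pair q (λ v → pair (αW u i) (K v j))))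
    ≡⟨ pair-conv p n (λ u i j → pair q (λ v → pair (αW u i) (K v j))) ⟨
  pair p (λ u → conv n (λ i j → pair q (λ v → pair (αW u i) (K v j))))
    ≡⟨ pair-cong p (λ u → pair-conv q n (λ v i j → pair (αW u i) (K v j))) ⟨
  pair p (λ u → pair q (λ v → αProduct u v n g)) ∎
  where
  open ≡-Reasoning
  K : Word → ℕ → Word → ℚ
  K v j u′ = pair (αW v j) (λ v′ → harSum u′ v′ g)

lemma6p5 : (w₁ w₂ : Poly) → InH1 w₁ → InH1 w₂ →
    αA (w₁ *h w₂) ≈S (αA w₁ *S αA w₂)
lemma6p5 w₁ w₂ h₁ h₂ n w = begin
  coeff (αA (w₁ *h w₂) n) w
    ≡⟨ coeff≡pair-δ (αA (w₁ *h w₂) n) w ⟩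
  pair (αA (w₁ *h w₂) n) (δ w)
    ≡⟨ pair-αA-*h w₁ w₂ n (δ w) ⟩
  pair w₁ (λ u → pair w₂ (λ v → sumList (harW u v) (λ t → pair (αW t n) (δ w))))
    ≡⟨ pair-congᴬ h₁ (λ hu → pair-congᴬ h₂ (λ hv → pair-α-harW hu hv n (δ w))) ⟩
  pair w₁ (λ u → pair w₂ (λ v → αProduct u v n (δ w)))
    ≡⟨ pair-αA-*S-αA w₁ w₂ n (δ w) ⟨
  pair ((αA w₁ *S αA w₂) n) (δ w)
    ≡⟨ coeff≡pair-δ ((αA w₁ *S αA w₂) n) w ⟨
  coeff ((αA w₁ *S αA w₂) n) w ∎
  where open ≡-Reasoning
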